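{- Let $\Gamma$ be a small context of the target theory and let $t, A$ be terms. If $\mathrm{Pack}(\Gamma,\Gamma) \vdash t : A$, then $\Gamma \vdash t[\gamma_{12}] : A[\gamma_{12}]$.
   Context: Framework: the $\lambda\Pi$-calculus modulo theory (terms $c\mid x\mid\mathtt{TYPE}\mid\mathtt{KIND}\mid\Pi x:A.\,B\mid\lambda x:A.\,t\mid t\,u$, contexts $\langle\rangle\mid\Gamma,x:C$, signatures of typed constants and rewrite rules, with its standard type system including conversion modulo $\beta$ and the rewrite rules). The prelude signature $\Sigma_{pre}$ declares $\mathit{Set}:\mathtt{TYPE}$, $o:\mathit{Set}$, $\mathit{El}:\mathit{Set}\to\mathtt{TYPE}$, $\mathit{Prf}:\mathit{El}\,o\to\mathtt{TYPE}$ and the constructors $\rightsquigarrow_d,\Rightarrow_d,\pi,\forall$ with their rewrite rules (e.g. $\mathit{El}\,(x\rightsquigarrow_d y)\hookrightarrow\Pi z:\mathit{El}\,x.\,\mathit{El}\,(y\,z)$). A type is small when it is convertible, via reversing the prelude rewrite rules, to a type built from $\mathit{Set}$ by arrows, or to one of the forms $\mathit{Prf}\,a$ / $\mathit{El}\,b$ extended by arrows into types built from $\mathit{Set}$ and by $\Pi$-quantification over such types; a small context is one all of whose declared types are small. The equality signature $\Sigma_{eq}$ contains, for all types $A,B$, constants $\mathsf{heq}_{A,B}:A\to B\to\mathit{El}\,o$ (we write $u\approx_{A,B}v$ for $\mathit{Prf}\,(\mathsf{heq}_{A,B}\,u\,v)$) and $\mathsf{refl}_A:\Pi u:A.\,u\approx_{A,A}u$,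 together with symmetry, transitivity, Leibniz, congruence and extensionality axioms. Target theory: $\vdash$ denotes derivability with respect to $\Sigma_{pre}\cup\Sigma_{eq}\cup\bar\Sigma_{\mathcal T}$, where $\bar\Sigma_{\mathcal T}$ contains only typed constants. Pack: for contexts $\Gamma_1,\Gamma_2$ of the same length declaring the same variables, $\mathrm{Pack}(\langle\rangle,\langle\rangle)=\langle\rangle$ and $\mathrm{Pack}((\Gamma_1,x:A_1),(\Gamma_2,x:A_2))=\mathrm{Pack}(\Gamma_1,\Gamma_2),\ x_1:A_1[\gamma_1],\ x_2:A_2[\gamma_2],\ p_x:x_1\approx_{A_1[\gamma_1],A_2[\gamma_2]}x_2$, where for each variable $z$, $z_1,z_2,p_z$ are fresh variables, $\gamma_1$ is the substitution $z\mapsto z_1$ and $\gamma_2$ is $z\mapsto z_2$. The substitution $\gamma_{12}$ replaces $z_1$ and $z_2$ by $z$ and $p_z$ by $\mathsf{refl}\,z$ (i.e. $\mathsf{refl}_A\,z$ at the appropriate type $A$). -}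

module Defs where

open import Data.Nat using (ℕ; zero; suc; _+_)
open import Data.Fin using (Fin; zero; suc)
open import Data.Bool using (Bool; true; false)
open import Data.Product using (Σ; ∃; _×_; _,_)
open import Data.Sum using (_⊎_)
open import Relation.Binary.PropositionalEquality using (_≡_)

-- Syntax of the λΠ-calculus modulo theory (intrinsically scoped de Bruijn
-- terms).  C is the type of names of the user constants of Σ̄_T.

data Pre : Set where
  PSet Po PEl PPrf P⇝ P⇒ Pπ P∀ : Pre

data Term (C : Set) (n : ℕ) : Set where
  var  : Fin n → Term C n
  type kind : Term C n
  Π    : Term C n → Term C (suc n) → Term C n
  ƛ    : Term C n → Term C (suc n) → Term C n
  _·_  : Term C n → Term C n → Term C n
  con  : C → Term C n
  pre  : Pre → Term C n
  -- the schematic constants of Σ_eq (indexed by types)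
  heq    : Term C n → Term C n → Term C n
  refl≈  : Term C n → Term C n
  sym≈   : Term C n → Term C n → Term C n
  trans≈ : Term C n → Term C n → Term C n → Term C n
  leib≈  : Term C n → Term C n
  cong≈  : Term C n → Term C (suc n) → Term C n → Term C (suc n) → Term C n
  ext≈   : Term C n → Term C (suc n) → Term C n → Term C (suc n) → Term C n

infixl 7 _·_

Ren : ℕ → ℕ → Set
Ren m n = Fin m → Fin n

liftR : ∀ {m n} → Ren m n → Ren (suc m) (suc n)
liftR ρ zero    = zero
liftR ρ (suc i) = suc (ρ i)

ren : ∀ {C m n} → Ren m n → Term C m → Term C n
ren ρ (var i) = var (ρ i)
ren ρ type = type
ren ρ kind = kind
ren ρ (Π A B) = Π (ren ρ A) (ren (liftR ρ) B)
ren ρ (ƛ A t) = ƛ (ren ρ A) (ren (liftR ρ) t)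
ren ρ (t · u) = ren ρ t · ren ρ u
ren ρ (con c) = con c
ren ρ (pre p) = pre p
ren ρ (heq A B) = heq (ren ρ A) (ren ρ B)
ren ρ (refl≈ A) = refl≈ (ren ρ A)
ren ρ (sym≈ A B) = sym≈ (ren ρ A) (ren ρ B)
ren ρ (trans≈ A B D) = trans≈ (ren ρ A) (ren ρ B) (ren ρ D)
ren ρ (leib≈ A) = leib≈ (ren ρ A)
ren ρ (cong≈ A B A' B') = cong≈ (ren ρ A) (ren (liftR ρ) B) (ren ρ A') (ren (liftR ρ) B')
ren ρ (ext≈ A B A' B') = ext≈ (ren ρ A) (ren (liftR ρ) B) (ren ρ A') (ren (liftR ρ) B')

wk : ∀ {C n} → Term C n → Term C (suc n)
wk = ren suc

↑ : ∀ {n} k → Ren n (k + n)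
↑ zero    i = i
↑ (suc k) i = suc (↑ k i)

wk^ : ∀ {C n} k → Term C n → Term C (k + n)
wk^ k = ren (↑ k)

close : ∀ {C n} → Term C 0 → Term C n
close = ren (λ ())

Sub : Set → ℕ → ℕ → Set
Sub C m n = Fin m → Term C n

liftS : ∀ {C m n} → Sub C m n → Sub C (suc m) (suc n)
liftS σ zero    = var zero
liftS σ (suc i) = wk (σ i)

sub : ∀ {C m n} → Sub C m n → Term C m → Term C n
sub σ (var i) = σ i
sub σ type = type
sub σ kind = kind
sub σ (Π A B) = Π (sub σ A) (sub (liftS σ) B)
sub σ (ƛ A t) = ƛ (sub σ A) (sub (liftS σ) t)
sub σ (t · u) = sub σ t · sub σ u
sub σ (con c) = con c
sub σ (pre p) = pre p
sub σ (heq A B) = heq (sub σ A) (sub σ B)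
sub σ (refl≈ A) = refl≈ (sub σ A)
sub σ (sym≈ A B) = sym≈ (sub σ A) (sub σ B)
sub σ (trans≈ A B D) = trans≈ (sub σ A) (sub σ B) (sub σ D)
sub σ (leib≈ A) = leib≈ (sub σ A)
sub σ (cong≈ A B A' B') = cong≈ (sub σ A) (sub (liftS σ) B) (sub σ A') (sub (liftS σ) B')
sub σ (ext≈ A B A' B') = ext≈ (sub σ A) (sub (liftS σ) B) (sub σ A') (sub (liftS σ) B')

_[_] : ∀ {C n} → Term C (suc n) → Term C n → Term C n
B [ u ] = sub σ B
  where
  σ : Sub _ _ _
  σ zero    = u
  σ (suc i) = var i

inst : ∀ {C n} k → Term C (suc n) → Fin (k + n) → Term C (k + n)
inst k B j = sub σ B
  where
  σ : Sub _ _ _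
  σ zero    = var j
  σ (suc i) = var (↑ k i)

_⇛_ : ∀ {C n} → Term C n → Term C n → Term C n
A ⇛ B = Π A (wk B)
infixr 5 _⇛_

`Set `o `El `Prf : ∀ {C n} → Term C n
`Set = pre PSet
`o   = pre Po
`El  = pre PEl
`Prf = pre PPrf

Eq≈ : ∀ {C n} → Term C n → Term C n → Term C n → Term C n → Term C n
Eq≈ A B u v = `Prf · (heq A B · u · v)

v0 : ∀ {n} → Fin (suc n)
v0 = zero
v1 : ∀ {n} → Fin (suc (suc n))
v1 = suc zero
v2 : ∀ {n} → Fin (suc (suc (suc n)))
v2 = suc (suc zero)
v3 : ∀ {n} → Fin (suc (suc (suc (suc n))))
v3 = suc (suc (suc zero))

preTy : ∀ {C n} → Pre → Term C n
preTy PSet = type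
preTy Po   = `Set
preTy PEl  = Π `Set type
preTy PPrf = Π (`El · `o) type
preTy P⇝   = Π `Set (Π (Π (`El · var v0) `Set) `Set)
preTy P⇒   = Π (`El · `o) (Π (Π (`Prf · var v0) `Set) `Set)
preTy Pπ   = Π (`El · `o) (Π (Π (`Prf · var v0) (`El · `o)) (`El · `o))
preTy P∀   = Π `Set (Π (Π (`El · var v0) (`El · `o)) (`El · `o))

heqTy : ∀ {C n} → Term C n → Term C n → Term C n
heqTy A B = A ⇛ B ⇛ (`El · `o)

reflTy : ∀ {C n} → Term C n → Term C n
reflTy A = Π A (Eq≈ (wk A) (wk A) (var v0) (var v0))

symTy : ∀ {C n} → Term C n → Term C n → Term C n
symTy A B = Π A (Π (wk B)
  (Eq≈ (wk^ 2 A) (wk^ 2 B) (var v1) (var v0) ⇛ Eq≈ (wk^ 2 B) (wk^ 2 A) (var v0) (var v1)))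

transTy : ∀ {C n} → Term C n → Term C n → Term C n → Term C n
transTy A B D = Π A (Π (wk B) (Π (wk^ 2 D)
  (Eq≈ (wk^ 3 A) (wk^ 3 B) (var v2) (var v1) ⇛
   Eq≈ (wk^ 3 B) (wk^ 3 D) (var v1) (var v0) ⇛
   Eq≈ (wk^ 3 A) (wk^ 3 D) (var v2) (var v0))))

-- leibniz_A : Π u:A. Π v:A. u ≈_{A,A} v → Π P:A → El o. Prf (P u) → Prf (P v)
leibTy : ∀ {C n} → Term C n → Term C n
leibTy A = Π A (Π (wk A)
  (Eq≈ (wk^ 2 A) (wk^ 2 A) (var v1) (var v0) ⇛
   Π (wk^ 2 A ⇛ (`El · `o))
     ((`Prf · (var v0 · var v2)) ⇛ (`Prf · (var v0 · var v1)))))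

-- cong : Π f:(Πx:A.B). Π f':(Πx:A'.B'). Π u:A. Π u':A'.
--          f ≈ f' → u ≈ u' → f u ≈_{B[u],B'[u']} f' u'
congTy : ∀ {C n} → Term C n → Term C (suc n) → Term C n → Term C (suc n) → Term C n
congTy A B A' B' = Π F (Π (wk F') (Π (wk^ 2 A) (Π (wk^ 3 A')
  (Eq≈ (wk^ 4 F) (wk^ 4 F') (var v3) (var v2) ⇛
   Eq≈ (wk^ 4 A) (wk^ 4 A') (var v1) (var v0) ⇛
   Eq≈ (inst 4 B v1) (inst 4 B' v0) (var v3 · var v1) (var v2 · var v0)))))
  where
  F  = Π A B
  F' = Π A' B'

-- ext : Π f:(Πx:A.B). Π f':(Πx:A'.B').
--         (Π x:A. Π x':A'. x ≈ x' → f x ≈_{B[x],B'[x']} f' x') → f ≈ f'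
extTy : ∀ {C n} → Term C n → Term C (suc n) → Term C n → Term C (suc n) → Term C n
extTy A B A' B' = Π F (Π (wk F')
  (Π (wk^ 2 A) (Π (wk^ 3 A')
     (Eq≈ (wk^ 4 A) (wk^ 4 A') (var v1) (var v0) ⇛
      Eq≈ (inst 4 B v1) (inst 4 B' v0) (var v3 · var v1) (var v2 · var v0)))
   ⇛ Eq≈ (wk^ 2 F) (wk^ 2 F') (var v1) (var v0)))
  where
  F  = Π A B
  F' = Π A' B'

-- Conversion: congruent equivalence closure of the rewrite rules of Σ_pre,
-- plus β when the flag is true.  (Σ_eq and Σ̄_T have no rewrite rules.)

data Conv {C : Set} (withβ : Bool) {n : ℕ} : Term C n → Term C n → Set where
  c-refl  : ∀ {t} → Conv withβ t t
  c-sym   : ∀ {t u} → Conv withβ t u → Conv withβ u t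
  c-trans : ∀ {t u v} → Conv withβ t u → Conv withβ u v → Conv withβ t v
  c-β     : ∀ {A t u} → withβ ≡ true → Conv withβ (ƛ A t · u) (t [ u ])
  c-El⇝   : ∀ {x y} → Conv withβ (`El · (pre P⇝ · x · y)) (Π (`El · x) (`El · (wk y · var v0)))
  c-El⇒   : ∀ {x y} → Conv withβ (`El · (pre P⇒ · x · y)) (Π (`Prf · x) (`El · (wk y · var v0)))
  c-Prfπ  : ∀ {x y} → Conv withβ (`Prf · (pre Pπ · x · y)) (Π (`Prf · x) (`Prf · (wk y · var v0)))
  c-Prf∀  : ∀ {x y} → Conv withβ (`Prf · (pre P∀ · x · y)) (Π (`El · x) (`Prf · (wk y · var v0)))
  c-Π     : ∀ {A A' B B'} → Conv withβ A A' → Conv withβ B B' → Conv withβ (Π A B) (Π A' B')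
  c-ƛ     : ∀ {A A' t t'} → Conv withβ A A' → Conv withβ t t' → Conv withβ (ƛ A t) (ƛ A' t')
  c-·     : ∀ {t t' u u'} → Conv withβ t t' → Conv withβ u u' → Conv withβ (t · u) (t' · u')
  c-heq   : ∀ {A A' B B'} → Conv withβ A A' → Conv withβ B B' → Conv withβ (heq A B) (heq A' B')
  c-refl≈ : ∀ {A A'} → Conv withβ A A' → Conv withβ (refl≈ A) (refl≈ A')
  c-sym≈  : ∀ {A A' B B'} → Conv withβ A A' → Conv withβ B B' → Conv withβ (sym≈ A B) (sym≈ A' B')
  c-trans≈ : ∀ {A A' B B' D D'} → Conv withβ A A' → Conv withβ B B' → Conv withβ D D' →
             Conv withβ (trans≈ A B D) (trans≈ A' B' D')
  c-leib≈ : ∀ {A A'} → Conv withβ A A' → Conv withβ (leib≈ A) (leib≈ A')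
  c-cong≈ : ∀ {A A₁ B B₁ A' A'₁ B' B'₁} → Conv withβ A A₁ → Conv withβ B B₁ →
            Conv withβ A' A'₁ → Conv withβ B' B'₁ →
            Conv withβ (cong≈ A B A' B') (cong≈ A₁ B₁ A'₁ B'₁)
  c-ext≈  : ∀ {A A₁ B B₁ A' A'₁ B' B'₁} → Conv withβ A A₁ → Conv withβ B B₁ →
            Conv withβ A' A'₁ → Conv withβ B' B'₁ →
            Conv withβ (ext≈ A B A' B') (ext≈ A₁ B₁ A'₁ B'₁)

_≡βR_ : ∀ {C n} → Term C n → Term C n → Set
t ≡βR u = Conv true t u

_≡R_ : ∀ {C n} → Term C n → Term C n → Set
t ≡R u = Conv false t u

-- Contexts and typing (signature Σ_pre ∪ Σ_eq ∪ Σ̄_T, where Σ̄_T is given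
-- by sig : C → Term C 0, assigning a closed type to each constant)

data Ctx (C : Set) : ℕ → Set where
  ∅   : Ctx C 0
  _▹_ : ∀ {n} → Ctx C n → Term C n → Ctx C (suc n)

infixl 4 _▹_

lookup : ∀ {C n} → Ctx C n → Fin n → Term C n
lookup (Γ ▹ A) zero    = wk A
lookup (Γ ▹ A) (suc i) = wk (lookup Γ i)

data Sort : Set where
  sType sKind : Sort

⌜_⌝ : ∀ {C n} → Sort → Term C n
⌜ sType ⌝ = type
⌜ sKind ⌝ = kind

mutual
  data WfCtx {C : Set} (sig : C → Term C 0) : ∀ {n} → Ctx C n → Set where
    wf-∅ : WfCtx sig ∅
    wf-, : ∀ {n} {Γ : Ctx C n} {A} → WfCtx sig Γ → sig ∣ Γ ⊢ A ∶ type → WfCtx sig (Γ ▹ A)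

  data _∣_⊢_∶_ {C : Set} (sig : C → Term C 0) {n : ℕ} (Γ : Ctx C n) :
               Term C n → Term C n → Set where
    ty-sort : WfCtx sig Γ → sig ∣ Γ ⊢ type ∶ kind
    ty-var  : ∀ {i} → WfCtx sig Γ → sig ∣ Γ ⊢ var i ∶ lookup Γ i
    ty-con  : ∀ {c} → WfCtx sig Γ → sig ∣ Γ ⊢ con c ∶ close (sig c)
    ty-pre  : ∀ {p} → WfCtx sig Γ → sig ∣ Γ ⊢ pre p ∶ preTy p
    ty-Π    : ∀ {A B} (s : Sort) → sig ∣ Γ ⊢ A ∶ type → sig ∣ (Γ ▹ A) ⊢ B ∶ ⌜ s ⌝ →
              sig ∣ Γ ⊢ Π A B ∶ ⌜ s ⌝
    ty-ƛ    : ∀ {A B t} (s : Sort) → sig ∣ Γ ⊢ A ∶ type → sig ∣ (Γ ▹ A) ⊢ B ∶ ⌜ s ⌝ →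
              sig ∣ (Γ ▹ A) ⊢ t ∶ B → sig ∣ Γ ⊢ ƛ A t ∶ Π A B
    ty-app  : ∀ {t u A B} → sig ∣ Γ ⊢ t ∶ Π A B → sig ∣ Γ ⊢ u ∶ A →
              sig ∣ Γ ⊢ t · u ∶ (B [ u ])
    ty-conv : ∀ {t A B} (s : Sort) → sig ∣ Γ ⊢ t ∶ A → sig ∣ Γ ⊢ B ∶ ⌜ s ⌝ → A ≡βR B →
              sig ∣ Γ ⊢ t ∶ B
    ty-heq  : ∀ {A B} → sig ∣ Γ ⊢ A ∶ type → sig ∣ Γ ⊢ B ∶ type →
              sig ∣ Γ ⊢ heq A B ∶ heqTy A B
    ty-refl≈ : ∀ {A} → sig ∣ Γ ⊢ A ∶ type → sig ∣ Γ ⊢ refl≈ A ∶ reflTy A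
    ty-sym≈ : ∀ {A B} → sig ∣ Γ ⊢ A ∶ type → sig ∣ Γ ⊢ B ∶ type →
              sig ∣ Γ ⊢ sym≈ A B ∶ symTy A B
    ty-trans≈ : ∀ {A B D} → sig ∣ Γ ⊢ A ∶ type → sig ∣ Γ ⊢ B ∶ type → sig ∣ Γ ⊢ D ∶ type →
              sig ∣ Γ ⊢ trans≈ A B D ∶ transTy A B D
    ty-leib≈ : ∀ {A} → sig ∣ Γ ⊢ A ∶ type → sig ∣ Γ ⊢ leib≈ A ∶ leibTy A
    ty-cong≈ : ∀ {A B A' B'} → sig ∣ Γ ⊢ A ∶ type → sig ∣ (Γ ▹ A) ⊢ B ∶ type →
              sig ∣ Γ ⊢ A' ∶ type → sig ∣ (Γ ▹ A') ⊢ B' ∶ type →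
              sig ∣ Γ ⊢ cong≈ A B A' B' ∶ congTy A B A' B'
    ty-ext≈ : ∀ {A B A' B'} → sig ∣ Γ ⊢ A ∶ type → sig ∣ (Γ ▹ A) ⊢ B ∶ type →
              sig ∣ Γ ⊢ A' ∶ type → sig ∣ (Γ ▹ A') ⊢ B' ∶ type →
              sig ∣ Γ ⊢ ext≈ A B A' B' ∶ extTy A B A' B'

WfSig : ∀ {C} → (C → Term C 0) → Set
WfSig {C} sig = (c : C) → Σ Sort λ s → sig ∣ ∅ ⊢ sig c ∶ ⌜ s ⌝

data SetArity {C n} : Term C n → Set where
  sa-Set : SetArity `Set
  sa-arr : ∀ {S} → SetArity S → SetArity (`Set ⇛ S)

data PrfElForm {C n} : Term C n → Set where
  pe-Prf : ∀ {a} → PrfElForm (`Prf · a)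
  pe-El  : ∀ {b} → PrfElForm (`El · b)
  pe-arr : ∀ {S T} → SetArity S → PrfElForm T → PrfElForm (S ⇛ T)
  pe-Π   : ∀ {A T} → PrfElForm A → PrfElForm T → PrfElForm (Π A T)

SmallType : ∀ {C n} → Term C n → Set
SmallType {C} {n} A = Σ (Term C n) λ B → (SetArity B ⊎ PrfElForm B) × (A ≡R B)

data SmallCtx {C} : ∀ {n} → Ctx C n → Set where
  sm-∅ : SmallCtx ∅
  sm-, : ∀ {n} {Γ : Ctx C n} {A} → SmallCtx Γ → SmallType A → SmallCtx (Γ ▹ A)

triple : ℕ → ℕ
triple zero    = zero
triple (suc n) = suc (suc (suc (triple n)))

-- in Pack(Γ₁,Γ₂) each variable z of Γ yields z₁, z₂, p_z (p_z is the last)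
γ₁ γ₂ : ∀ {n} → Ren n (triple n)
γ₁ zero    = suc (suc zero)
γ₁ (suc i) = suc (suc (suc (γ₁ i)))
γ₂ zero    = suc zero
γ₂ (suc i) = suc (suc (suc (γ₂ i)))

Pack : ∀ {C n} → Ctx C n → Ctx C n → Ctx C (triple n)
Pack ∅ ∅ = ∅
Pack (Γ₁ ▹ A₁) (Γ₂ ▹ A₂) =
  Pack Γ₁ Γ₂ ▹ ren γ₁ A₁ ▹ ren (λ i → suc (γ₂ i)) A₂
    ▹ Eq≈ (wk^ 2 (ren γ₁ A₁)) (wk (ren (λ i → suc (γ₂ i)) A₂)) (var v1) (var v0)

γ₁₂ : ∀ {C n} → Ctx C n → Sub C (triple n) n
γ₁₂ ∅ ()
γ₁₂ (Γ ▹ A) zero                   = refl≈ (wk A) · var v0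
γ₁₂ (Γ ▹ A) (suc zero)             = var v0
γ₁₂ (Γ ▹ A) (suc (suc zero))       = var v0
γ₁₂ (Γ ▹ A) (suc (suc (suc i)))    = wk (γ₁₂ Γ i)

{-# OPTIONS --safe #-}
-- γ₁₂ is a well-typed substitution from Pack(Γ,Γ) to Γ: it sends z₁ and z₂ to z, and the declared
-- types A[γ₁], A[γ₂] of z₁, z₂ both become A under γ₁₂; it sends p_z to refl_A z, whose type
-- z ≈_{A,A} z is exactly the γ₁₂-image of the declared type z₁ ≈ z₂ of p_z. The claim is then an
-- instance of the substitution lemma.
module Submission where

open import Defs
open import Data.Nat using (ℕ; zero; suc; _+_)
open import Data.Fin using (Fin; zero; suc)
open import Data.Product using (Σ; ∃; _×_; _,_)
open import Data.Unit using (⊤; tt)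
open import Function using (_∘_; id)
open import Relation.Binary.PropositionalEquality
  using (_≡_; refl; sym; trans; cong; cong₂; subst; subst₂; _≗_; module ≡-Reasoning)

variable
  C : Set
  m n k : ℕ

cong₃ : {A B D E : Set} (f : A → B → D → E) {a a' : A} {b b' : B} {d d' : D} →
        a ≡ a' → b ≡ b' → d ≡ d' → f a b d ≡ f a' b' d'
cong₃ f refl refl refl = refl

cong₄ : {A B D E F : Set} (f : A → B → D → E → F) {a a' : A} {b b' : B} {d d' : D} {e e' : E} →
        a ≡ a' → b ≡ b' → d ≡ d' → e ≡ e' → f a b d e ≡ f a' b' d' e'
cong₄ f refl refl refl refl = refl

IsRenaming : Sub C m n → Set
IsRenaming {m = m} {n} σ = Σ (Ren m n) λ ρ → σ ≗ var ∘ ρ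

liftS-var : {σ : Sub C m n} {ρ : Ren m n} → σ ≗ var ∘ ρ → liftS σ ≗ var ∘ liftR ρ
liftS-var h zero    = refl
liftS-var h (suc i) = cong wk (h i)

ren-as-sub : {ρ : Ren m n} {σ : Sub C m n} → σ ≗ var ∘ ρ → (t : Term C m) → ren ρ t ≡ sub σ t
ren-as-sub h (var i)           = sym (h i)
ren-as-sub h type              = refl
ren-as-sub h kind              = refl
ren-as-sub h (Π A B)           = cong₂ Π (ren-as-sub h A) (ren-as-sub (liftS-var h) B)
ren-as-sub h (ƛ A t)           = cong₂ ƛ (ren-as-sub h A) (ren-as-sub (liftS-var h) t)
ren-as-sub h (t · u)           = cong₂ _·_ (ren-as-sub h t) (ren-as-sub h u)
ren-as-sub h (con c)           = refl
ren-as-sub h (pre p)           = refl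
ren-as-sub h (heq A B)         = cong₂ heq (ren-as-sub h A) (ren-as-sub h B)
ren-as-sub h (refl≈ A)         = cong refl≈ (ren-as-sub h A)
ren-as-sub h (sym≈ A B)        = cong₂ sym≈ (ren-as-sub h A) (ren-as-sub h B)
ren-as-sub h (trans≈ A B D)    = cong₃ trans≈ (ren-as-sub h A) (ren-as-sub h B) (ren-as-sub h D)
ren-as-sub h (leib≈ A)         = cong leib≈ (ren-as-sub h A)
ren-as-sub h (cong≈ A B A' B') =
  cong₄ cong≈ (ren-as-sub h A) (ren-as-sub (liftS-var h) B)
              (ren-as-sub h A') (ren-as-sub (liftS-var h) B')
ren-as-sub h (ext≈ A B A' B')  =
  cong₄ ext≈ (ren-as-sub h A) (ren-as-sub (liftS-var h) B)
             (ren-as-sub h A') (ren-as-sub (liftS-var h) B')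

wk-as-sub : (t : Term C n) → wk t ≡ sub (var ∘ suc) t
wk-as-sub = ren-as-sub λ _ → refl

liftS-id : {σ : Sub C n n} → σ ≗ var → liftS σ ≗ var
liftS-id h zero    = refl
liftS-id h (suc i) = cong wk (h i)

sub-id : {σ : Sub C n n} → σ ≗ var → (t : Term C n) → sub σ t ≡ t
sub-id h (var i)           = h i
sub-id h type              = refl
sub-id h kind              = refl
sub-id h (Π A B)           = cong₂ Π (sub-id h A) (sub-id (liftS-id h) B)
sub-id h (ƛ A t)           = cong₂ ƛ (sub-id h A) (sub-id (liftS-id h) t)
sub-id h (t · u)           = cong₂ _·_ (sub-id h t) (sub-id h u)
sub-id h (con c)           = refl
sub-id h (pre p)           = refl
sub-id h (heq A B)         = cong₂ heq (sub-id h A) (sub-id h B)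
sub-id h (refl≈ A)         = cong refl≈ (sub-id h A)
sub-id h (sym≈ A B)        = cong₂ sym≈ (sub-id h A) (sub-id h B)
sub-id h (trans≈ A B D)    = cong₃ trans≈ (sub-id h A) (sub-id h B) (sub-id h D)
sub-id h (leib≈ A)         = cong leib≈ (sub-id h A)
sub-id h (cong≈ A B A' B') =
  cong₄ cong≈ (sub-id h A) (sub-id (liftS-id h) B) (sub-id h A') (sub-id (liftS-id h) B')
sub-id h (ext≈ A B A' B')  =
  cong₄ ext≈ (sub-id h A) (sub-id (liftS-id h) B) (sub-id h A') (sub-id (liftS-id h) B')

-- At a binder, the fusion law sub σ ∘ sub τ = sub (sub σ ∘ τ) needs weakening to commute with the
-- lifted σ on the image of τ, which is itself a fusion law. So the induction is done once for any
-- class of pairs closed under lifting on which this holds, and bootstrapped from renamings.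
module Fusion
  (Allowed : ∀ {C m n k} → Sub C m n → Sub C n k → Set)
  (allowed-lift : ∀ {C m n k} {τ : Sub C m n} {σ : Sub C n k} →
                  Allowed τ σ → Allowed (liftS τ) (liftS σ))
  (allowed-wk : ∀ {C m n k} {τ : Sub C m n} {σ : Sub C n k} → Allowed τ σ →
                ∀ i → sub (liftS σ) (wk (τ i)) ≡ wk (sub σ (τ i)))
  where

  fuse-lift : {τ : Sub C m n} {σ : Sub C n k} {υ : Sub C m k} → Allowed τ σ →
              sub σ ∘ τ ≗ υ → sub (liftS σ) ∘ liftS τ ≗ liftS υ
  fuse-lift g h zero    = refl
  fuse-lift g h (suc i) = trans (allowed-wk g i) (cong wk (h i))

  fuse : {τ : Sub C m n} {σ : Sub C n k} {υ : Sub C m k} → Allowed τ σ →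
         sub σ ∘ τ ≗ υ → (t : Term C m) → sub σ (sub τ t) ≡ sub υ t
  fuse g h (var i)           = h i
  fuse g h type              = refl
  fuse g h kind              = refl
  fuse g h (Π A B)           = cong₂ Π (fuse g h A) (fuse (allowed-lift g) (fuse-lift g h) B)
  fuse g h (ƛ A t)           = cong₂ ƛ (fuse g h A) (fuse (allowed-lift g) (fuse-lift g h) t)
  fuse g h (t · u)           = cong₂ _·_ (fuse g h t) (fuse g h u)
  fuse g h (con c)           = refl
  fuse g h (pre p)           = refl
  fuse g h (heq A B)         = cong₂ heq (fuse g h A) (fuse g h B)
  fuse g h (refl≈ A)         = cong refl≈ (fuse g h A)
  fuse g h (sym≈ A B)        = cong₂ sym≈ (fuse g h A) (fuse g h B)
  fuse g h (trans≈ A B D)    = cong₃ trans≈ (fuse g h A) (fuse g h B) (fuse g h D)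
  fuse g h (leib≈ A)         = cong leib≈ (fuse g h A)
  fuse g h (cong≈ A B A' B') =
    cong₄ cong≈ (fuse g h A) (fuse (allowed-lift g) (fuse-lift g h) B)
                (fuse g h A') (fuse (allowed-lift g) (fuse-lift g h) B')
  fuse g h (ext≈ A B A' B')  =
    cong₄ ext≈ (fuse g h A) (fuse (allowed-lift g) (fuse-lift g h) B)
               (fuse g h A') (fuse (allowed-lift g) (fuse-lift g h) B')

IsRenaming-lift : {σ : Sub C m n} → IsRenaming σ → IsRenaming (liftS σ)
IsRenaming-lift (ρ , h) = liftR ρ , liftS-var h

sub-wk-of-ren : {τ : Sub C m n} {σ : Sub C n k} → IsRenaming τ →
                ∀ i → sub (liftS σ) (wk (τ i)) ≡ wk (sub σ (τ i))
sub-wk-of-ren (ρ , h) i rewrite h i = refl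

module SubRen = Fusion (λ τ σ → IsRenaming τ) IsRenaming-lift sub-wk-of-ren

sub-ren : (σ : Sub C n k) (ρ : Ren m n) (t : Term C m) → sub σ (ren ρ t) ≡ sub (σ ∘ ρ) t
sub-ren σ ρ t =
  trans (cong (sub σ) (ren-as-sub (λ _ → refl) t)) (SubRen.fuse (ρ , λ _ → refl) (λ _ → refl) t)

sub-cong : {σ σ' : Sub C m n} → σ ≗ σ' → (t : Term C m) → sub σ t ≡ sub σ' t
sub-cong {σ = σ} h t =
  trans (cong (sub σ) (sym (sub-id (λ _ → refl) t))) (SubRen.fuse (id , λ _ → refl) h t)

ren-ren : (ρ' : Ren n k) (ρ : Ren m n) (t : Term C m) → ren ρ' (ren ρ t) ≡ ren (ρ' ∘ ρ) t
ren-ren ρ' ρ t = begin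
  ren ρ' (ren ρ t)         ≡⟨ ren-as-sub (λ _ → refl) (ren ρ t) ⟩
  sub (var ∘ ρ') (ren ρ t) ≡⟨ sub-ren (var ∘ ρ') ρ t ⟩
  sub (var ∘ ρ' ∘ ρ) t     ≡⟨ sym (ren-as-sub (λ _ → refl) t) ⟩
  ren (ρ' ∘ ρ) t           ∎
  where open ≡-Reasoning

sub-wk-by-ren : {σ : Sub C m n} → IsRenaming σ →
                (t : Term C m) → sub (liftS σ) (wk t) ≡ wk (sub σ t)
sub-wk-by-ren {σ = σ} σ-ren t = begin
  sub (liftS σ) (wk t)      ≡⟨ sub-ren (liftS σ) suc t ⟩
  sub (wk ∘ σ) t            ≡⟨ sym (SubRen.fuse σ-ren (sym ∘ wk-as-sub ∘ σ) t) ⟩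
  sub (var ∘ suc) (sub σ t) ≡⟨ sym (wk-as-sub (sub σ t)) ⟩
  wk (sub σ t)              ∎
  where open ≡-Reasoning

module RenSub =
  Fusion (λ τ σ → IsRenaming σ) IsRenaming-lift (λ {τ = τ} σ-ren i → sub-wk-by-ren σ-ren (τ i))

ren-sub : (ρ : Ren n k) (σ : Sub C m n) (t : Term C m) → ren ρ (sub σ t) ≡ sub (ren ρ ∘ σ) t
ren-sub ρ σ t = trans (ren-as-sub (λ _ → refl) (sub σ t))
  (RenSub.fuse (ρ , λ _ → refl) (sym ∘ ren-as-sub (λ _ → refl) ∘ σ) t)

sub-wk : (σ : Sub C m n) (t : Term C m) → sub (liftS σ) (wk t) ≡ wk (sub σ t)
sub-wk σ t = trans (sub-ren (liftS σ) suc t) (sym (ren-sub suc σ t))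

module SubSub = Fusion (λ τ σ → ⊤) (λ _ → tt) (λ {τ = τ} {σ} _ i → sub-wk σ (τ i))

sub-sub : (σ : Sub C n k) (τ : Sub C m n) (t : Term C m) → sub σ (sub τ t) ≡ sub (sub σ ∘ τ) t
sub-sub σ τ = SubSub.fuse tt λ _ → refl

liftS^ : ∀ k → Sub C m n → Sub C (k + m) (k + n)
liftS^ zero    σ = σ
liftS^ (suc k) σ = liftS (liftS^ k σ)

wk^-zero : (t : Term C n) → wk^ 0 t ≡ t
wk^-zero t = trans (ren-as-sub (λ _ → refl) t) (sub-id (λ _ → refl) t)

wk^-suc : ∀ k (t : Term C n) → wk^ (suc k) t ≡ wk (wk^ k t)
wk^-suc k t = sym (ren-ren suc (↑ k) t)

liftS^-↑ : ∀ k (σ : Sub C m n) → liftS^ k σ ∘ ↑ k ≗ wk^ k ∘ σ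
liftS^-↑ zero    σ i = sym (wk^-zero (σ i))
liftS^-↑ (suc k) σ i = trans (cong wk (liftS^-↑ k σ i)) (sym (wk^-suc k (σ i)))

sub-wk^ : ∀ k (σ : Sub C m n) (t : Term C m) → sub (liftS^ k σ) (wk^ k t) ≡ wk^ k (sub σ t)
sub-wk^ k σ t = begin
  sub (liftS^ k σ) (wk^ k t) ≡⟨ sub-ren (liftS^ k σ) (↑ k) t ⟩
  sub (liftS^ k σ ∘ ↑ k) t   ≡⟨ sub-cong (liftS^-↑ k σ) t ⟩
  sub (wk^ k ∘ σ) t          ≡⟨ sym (ren-sub (↑ k) σ t) ⟩
  wk^ k (sub σ t)            ∎
  where open ≡-Reasoning

infixl 4 _,ₛ_

_,ₛ_ : Sub C m n → Term C n → Sub C (suc m) n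
(σ ,ₛ u) zero    = u
(σ ,ₛ u) (suc i) = σ i

[]-as-sub : (B : Term C (suc n)) (u : Term C n) → B [ u ] ≡ sub (var ,ₛ u) B
[]-as-sub B u = sub-cong (λ { zero → refl ; (suc i) → refl }) B

inst-as-sub : ∀ k (B : Term C (suc n)) (j : Fin (k + n)) → inst k B j ≡ sub (var ∘ ↑ k ,ₛ var j) B
inst-as-sub k B j = sub-cong (λ { zero → refl ; (suc i) → refl }) B

sub-[] : (σ : Sub C m n) (B : Term C (suc m)) (u : Term C m) →
         sub σ (B [ u ]) ≡ sub (liftS σ) B [ sub σ u ]
sub-[] σ B u = begin
  sub σ (B [ u ])                                ≡⟨ cong (sub σ) ([]-as-sub B u) ⟩
  sub σ (sub (var ,ₛ u) B)                       ≡⟨ sub-sub σ (var ,ₛ u) B ⟩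
  sub (sub σ ∘ (var ,ₛ u)) B                     ≡⟨ sub-cong pointwise B ⟩
  sub (sub (var ,ₛ sub σ u) ∘ liftS σ) B         ≡⟨ sym (sub-sub (var ,ₛ sub σ u) (liftS σ) B) ⟩
  sub (var ,ₛ sub σ u) (sub (liftS σ) B)         ≡⟨ sym ([]-as-sub (sub (liftS σ) B) (sub σ u)) ⟩
  sub (liftS σ) B [ sub σ u ]                    ∎
  where
  open ≡-Reasoning
  pointwise : sub σ ∘ (var ,ₛ u) ≗ sub (var ,ₛ sub σ u) ∘ liftS σ
  pointwise zero    = refl
  pointwise (suc i) = sym (trans (sub-ren (var ,ₛ sub σ u) suc (σ i)) (sub-id (λ _ → refl) (σ i)))

sub-inst : ∀ k (σ : Sub C m n) (B : Term C (suc m)) {j j'} → liftS^ k σ j ≡ var j' →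
           sub (liftS^ k σ) (inst k B j) ≡ inst k (sub (liftS σ) B) j'
sub-inst k σ B {j} {j'} σj = begin
  sub (liftS^ k σ) (inst k B j)                    ≡⟨ cong (sub (liftS^ k σ)) (inst-as-sub k B j) ⟩
  sub (liftS^ k σ) (sub (var ∘ ↑ k ,ₛ var j) B)    ≡⟨ sub-sub (liftS^ k σ) (var ∘ ↑ k ,ₛ var j) B ⟩
  sub (sub (liftS^ k σ) ∘ (var ∘ ↑ k ,ₛ var j)) B  ≡⟨ sub-cong pointwise B ⟩
  sub (sub (var ∘ ↑ k ,ₛ var j') ∘ liftS σ) B      ≡⟨ sym (sub-sub (var ∘ ↑ k ,ₛ var j') (liftS σ) B) ⟩
  sub (var ∘ ↑ k ,ₛ var j') (sub (liftS σ) B)      ≡⟨ sym (inst-as-sub k (sub (liftS σ) B) j') ⟩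
  inst k (sub (liftS σ) B) j'                      ∎
  where
  open ≡-Reasoning
  pointwise : sub (liftS^ k σ) ∘ (var ∘ ↑ k ,ₛ var j) ≗ sub (var ∘ ↑ k ,ₛ var j') ∘ liftS σ
  pointwise zero    = σj
  pointwise (suc i) = begin
    liftS^ k σ (↑ k i)                      ≡⟨ liftS^-↑ k σ i ⟩
    wk^ k (σ i)                             ≡⟨ ren-as-sub (λ _ → refl) (σ i) ⟩
    sub (var ∘ ↑ k) (σ i)                   ≡⟨ sym (sub-ren (var ∘ ↑ k ,ₛ var j') suc (σ i)) ⟩
    sub (var ∘ ↑ k ,ₛ var j') (wk (σ i))    ∎

sub-⇛ : (σ : Sub C m n) (A B : Term C m) → sub σ (A ⇛ B) ≡ sub σ A ⇛ sub σ B
sub-⇛ σ A B = cong (Π (sub σ A)) (sub-wk σ B)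

Eq≈-cong : {X X' Y Y' u v : Term C n} → X ≡ X' → Y ≡ Y' → Eq≈ X Y u v ≡ Eq≈ X' Y' u v
Eq≈-cong refl refl = refl

sub-close : (σ : Sub C m n) (T : Term C 0) → sub σ (close T) ≡ close T
sub-close σ T = begin
  sub σ (close T)   ≡⟨ sub-ren σ (λ ()) T ⟩
  sub (σ ∘ λ ()) T  ≡⟨ sub-cong (λ ()) T ⟩
  sub (λ ()) T      ≡⟨ sym (ren-as-sub (λ ()) T) ⟩
  close T           ∎
  where open ≡-Reasoning

sub-preTy : (σ : Sub C m n) (p : Pre) → sub σ (preTy p) ≡ preTy p
sub-preTy σ PSet = refl
sub-preTy σ Po   = refl
sub-preTy σ PEl  = refl
sub-preTy σ PPrf = refl
sub-preTy σ P⇝   = refl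
sub-preTy σ P⇒   = refl
sub-preTy σ Pπ   = refl
sub-preTy σ P∀   = refl

sub-heqTy : (σ : Sub C m n) (A B : Term C m) → sub σ (heqTy A B) ≡ heqTy (sub σ A) (sub σ B)
sub-heqTy σ A B =
  trans (sub-⇛ σ A (B ⇛ `El · `o)) (cong (sub σ A ⇛_) (sub-⇛ σ B (`El · `o)))

sub-reflTy : (σ : Sub C m n) (A : Term C m) → sub σ (reflTy A) ≡ reflTy (sub σ A)
sub-reflTy σ A = cong (Π (sub σ A)) (Eq≈-cong (sub-wk σ A) (sub-wk σ A))

sub-symTy : (σ : Sub C m n) (A B : Term C m) → sub σ (symTy A B) ≡ symTy (sub σ A) (sub σ B)
sub-symTy σ A B = cong (Π (sub σ A)) (cong₂ Π (sub-wk σ B) (trans (sub-⇛ (liftS^ 2 σ) E E⁻¹)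
  (cong₂ _⇛_ (Eq≈-cong (sub-wk^ 2 σ A) (sub-wk^ 2 σ B)) (Eq≈-cong (sub-wk^ 2 σ B) (sub-wk^ 2 σ A)))))
  where
  E   = Eq≈ (wk^ 2 A) (wk^ 2 B) (var v1) (var v0)
  E⁻¹ = Eq≈ (wk^ 2 B) (wk^ 2 A) (var v0) (var v1)

sub-transTy : (σ : Sub C m n) (A B D : Term C m) →
              sub σ (transTy A B D) ≡ transTy (sub σ A) (sub σ B) (sub σ D)
sub-transTy σ A B D =
  cong (Π (sub σ A)) (cong₂ Π (sub-wk σ B) (cong₂ Π (sub-wk^ 2 σ D)
    (trans (sub-⇛ σ³ E₁₂ (E₂₃ ⇛ E₁₃)) (cong₂ _⇛_ (Eq≈-cong (sub-wk^ 3 σ A) (sub-wk^ 3 σ B))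
      (trans (sub-⇛ σ³ E₂₃ E₁₃) (cong₂ _⇛_ (Eq≈-cong (sub-wk^ 3 σ B) (sub-wk^ 3 σ D))
                                           (Eq≈-cong (sub-wk^ 3 σ A) (sub-wk^ 3 σ D))))))))
  where
  σ³  = liftS^ 3 σ
  E₁₂ = Eq≈ (wk^ 3 A) (wk^ 3 B) (var v2) (var v1)
  E₂₃ = Eq≈ (wk^ 3 B) (wk^ 3 D) (var v1) (var v0)
  E₁₃ = Eq≈ (wk^ 3 A) (wk^ 3 D) (var v2) (var v0)

sub-leibTy : (σ : Sub C m n) (A : Term C m) → sub σ (leibTy A) ≡ leibTy (sub σ A)
sub-leibTy σ A = cong (Π (sub σ A)) (cong₂ Π (sub-wk σ A)
  (trans (sub-⇛ σ² E (Π (wk^ 2 A ⇛ `El · `o) (P₁ ⇛ P₂)))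
    (cong₂ _⇛_ (Eq≈-cong (sub-wk^ 2 σ A) (sub-wk^ 2 σ A))
      (cong₂ Π (trans (sub-⇛ σ² (wk^ 2 A) (`El · `o)) (cong (_⇛ `El · `o) (sub-wk^ 2 σ A)))
               (sub-⇛ (liftS σ²) P₁ P₂)))))
  where
  σ² = liftS^ 2 σ
  E  = Eq≈ (wk^ 2 A) (wk^ 2 A) (var v1) (var v0)
  P₁ P₂ : Term _ _
  P₁ = `Prf · (var v0 · var v2)
  P₂ = `Prf · (var v0 · var v1)

sub-congTy : (σ : Sub C m n) (A : Term C m) (B : Term C (suc m))
             (A' : Term C m) (B' : Term C (suc m)) →
  sub σ (congTy A B A' B') ≡ congTy (sub σ A) (sub (liftS σ) B) (sub σ A') (sub (liftS σ) B')
sub-congTy σ A B A' B' = cong (Π _) (cong₂ Π (sub-wk σ (Π A' B')) (cong₂ Π (sub-wk^ 2 σ A)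
  (cong₂ Π (sub-wk^ 3 σ A')
    (trans (sub-⇛ σ⁴ E-fun (E-arg ⇛ E-app)) (cong₂ _⇛_
      (Eq≈-cong (sub-wk^ 4 σ (Π A B)) (sub-wk^ 4 σ (Π A' B')))
      (trans (sub-⇛ σ⁴ E-arg E-app) (cong₂ _⇛_
        (Eq≈-cong (sub-wk^ 4 σ A) (sub-wk^ 4 σ A'))
        (Eq≈-cong (sub-inst 4 σ B refl) (sub-inst 4 σ B' refl)))))))))
  where
  σ⁴    = liftS^ 4 σ
  E-fun = Eq≈ (wk^ 4 (Π A B)) (wk^ 4 (Π A' B')) (var v3) (var v2)
  E-arg = Eq≈ (wk^ 4 A) (wk^ 4 A') (var v1) (var v0)
  E-app = Eq≈ (inst 4 B v1) (inst 4 B' v0) (var v3 · var v1) (var v2 · var v0)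

sub-extTy : (σ : Sub C m n) (A : Term C m) (B : Term C (suc m))
             (A' : Term C m) (B' : Term C (suc m)) →
  sub σ (extTy A B A' B') ≡ extTy (sub σ A) (sub (liftS σ) B) (sub σ A') (sub (liftS σ) B')
sub-extTy σ A B A' B' = cong (Π _) (cong₂ Π (sub-wk σ (Π A' B'))
  (trans (sub-⇛ (liftS^ 2 σ) E-pointwise E-fun) (cong₂ _⇛_
    (cong₂ Π (sub-wk^ 2 σ A) (cong₂ Π (sub-wk^ 3 σ A')
      (trans (sub-⇛ (liftS^ 4 σ) E-arg E-app) (cong₂ _⇛_
        (Eq≈-cong (sub-wk^ 4 σ A) (sub-wk^ 4 σ A'))
        (Eq≈-cong (sub-inst 4 σ B refl) (sub-inst 4 σ B' refl))))))
    (Eq≈-cong (sub-wk^ 2 σ (Π A B)) (sub-wk^ 2 σ (Π A' B'))))))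
  where
  E-arg       = Eq≈ (wk^ 4 A) (wk^ 4 A') (var v1) (var v0)
  E-app       = Eq≈ (inst 4 B v1) (inst 4 B' v0) (var v3 · var v1) (var v2 · var v0)
  E-pointwise = Π (wk^ 2 A) (Π (wk^ 3 A') (E-arg ⇛ E-app))
  E-fun       = Eq≈ (wk^ 2 (Π A B)) (wk^ 2 (Π A' B')) (var v1) (var v0)

conv-sub : ∀ {b} (σ : Sub C m n) {t u : Term C m} → Conv b t u → Conv b (sub σ t) (sub σ u)
conv-sub σ c-refl                      = c-refl
conv-sub σ (c-sym c)                   = c-sym (conv-sub σ c)
conv-sub σ (c-trans c d)               = c-trans (conv-sub σ c) (conv-sub σ d)
conv-sub σ (c-β {t = t} {u} β)         rewrite sub-[] σ t u = c-β β
conv-sub σ (c-El⇝ {y = y})             rewrite sub-wk σ y = c-El⇝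
conv-sub σ (c-El⇒ {y = y})             rewrite sub-wk σ y = c-El⇒
conv-sub σ (c-Prfπ {y = y})            rewrite sub-wk σ y = c-Prfπ
conv-sub σ (c-Prf∀ {y = y})            rewrite sub-wk σ y = c-Prf∀
conv-sub σ (c-Π c d)                   = c-Π (conv-sub σ c) (conv-sub (liftS σ) d)
conv-sub σ (c-ƛ c d)                   = c-ƛ (conv-sub σ c) (conv-sub (liftS σ) d)
conv-sub σ (c-· c d)                   = c-· (conv-sub σ c) (conv-sub σ d)
conv-sub σ (c-heq c d)                 = c-heq (conv-sub σ c) (conv-sub σ d)
conv-sub σ (c-refl≈ c)                 = c-refl≈ (conv-sub σ c)
conv-sub σ (c-sym≈ c d)                = c-sym≈ (conv-sub σ c) (conv-sub σ d)
conv-sub σ (c-trans≈ c d e)            = c-trans≈ (conv-sub σ c) (conv-sub σ d) (conv-sub σ e)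
conv-sub σ (c-leib≈ c)                 = c-leib≈ (conv-sub σ c)
conv-sub σ (c-cong≈ c d e f)           =
  c-cong≈ (conv-sub σ c) (conv-sub (liftS σ) d) (conv-sub σ e) (conv-sub (liftS σ) f)
conv-sub σ (c-ext≈ c d e f)            =
  c-ext≈ (conv-sub σ c) (conv-sub (liftS σ) d) (conv-sub σ e) (conv-sub (liftS σ) f)

⊢-cast : {sig : C → Term C 0} {Δ : Ctx C n} {t T T' : Term C n} →
         T ≡ T' → sig ∣ Δ ⊢ t ∶ T → sig ∣ Δ ⊢ t ∶ T'
⊢-cast = subst (_ ∣ _ ⊢ _ ∶_)

-- Parametrised by the class of admissible substitutions: renamings give weakening, which is what
-- lifts a well-typed substitution under a binder.
module Preservation {C : Set} (sig : C → Term C 0)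
  (Admissible : ∀ {m n} → Ctx C m → Sub C m n → Ctx C n → Set)
  (admissible-wf : ∀ {m n} {Γ : Ctx C m} {σ} {Δ : Ctx C n} → Admissible Γ σ Δ → WfCtx sig Δ)
  (admissible-var : ∀ {m n} {Γ : Ctx C m} {σ} {Δ : Ctx C n} → Admissible Γ σ Δ →
                    ∀ i → sig ∣ Δ ⊢ σ i ∶ sub σ (lookup Γ i))
  (admissible-lift : ∀ {m n} {Γ : Ctx C m} {σ} {Δ : Ctx C n} {A} → Admissible Γ σ Δ →
                     sig ∣ Δ ⊢ sub σ A ∶ type → Admissible (Γ ▹ A) (liftS σ) (Δ ▹ sub σ A))
  where

  mutual
    ⊢sub : {Γ : Ctx C m} {σ : Sub C m n} {Δ : Ctx C n} {t T : Term C m} →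
           Admissible Γ σ Δ → sig ∣ Γ ⊢ t ∶ T → sig ∣ Δ ⊢ sub σ t ∶ sub σ T
    ⊢sub a (ty-sort _)                = ty-sort (admissible-wf a)
    ⊢sub a (ty-var {i} _)             = admissible-var a i
    ⊢sub {σ = σ} a (ty-con {c} _)     = ⊢-cast (sym (sub-close σ (sig c))) (ty-con (admissible-wf a))
    ⊢sub {σ = σ} a (ty-pre {p} _)     = ⊢-cast (sym (sub-preTy σ p)) (ty-pre (admissible-wf a))
    ⊢sub a (ty-Π sType dA dB)         = ty-Π sType (⊢sub a dA) (⊢sub (lift-admissible a dA) dB)
    ⊢sub a (ty-Π sKind dA dB)         = ty-Π sKind (⊢sub a dA) (⊢sub (lift-admissible a dA) dB)
    ⊢sub a (ty-ƛ sType dA dB dt)      =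
      ty-ƛ sType (⊢sub a dA) (⊢sub (lift-admissible a dA) dB) (⊢sub (lift-admissible a dA) dt)
    ⊢sub a (ty-ƛ sKind dA dB dt)      =
      ty-ƛ sKind (⊢sub a dA) (⊢sub (lift-admissible a dA) dB) (⊢sub (lift-admissible a dA) dt)
    ⊢sub {σ = σ} a (ty-app {u = u} {B = B} dt du) =
      ⊢-cast (sym (sub-[] σ B u)) (ty-app (⊢sub a dt) (⊢sub a du))
    ⊢sub {σ = σ} a (ty-conv sType dt dB c) = ty-conv sType (⊢sub a dt) (⊢sub a dB) (conv-sub σ c)
    ⊢sub {σ = σ} a (ty-conv sKind dt dB c) = ty-conv sKind (⊢sub a dt) (⊢sub a dB) (conv-sub σ c)
    ⊢sub {σ = σ} a (ty-heq {A} {B} dA dB) =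
      ⊢-cast (sym (sub-heqTy σ A B)) (ty-heq (⊢sub a dA) (⊢sub a dB))
    ⊢sub {σ = σ} a (ty-refl≈ {A} dA) =
      ⊢-cast (sym (sub-reflTy σ A)) (ty-refl≈ (⊢sub a dA))
    ⊢sub {σ = σ} a (ty-sym≈ {A} {B} dA dB) =
      ⊢-cast (sym (sub-symTy σ A B)) (ty-sym≈ (⊢sub a dA) (⊢sub a dB))
    ⊢sub {σ = σ} a (ty-trans≈ {A} {B} {D} dA dB dD) =
      ⊢-cast (sym (sub-transTy σ A B D)) (ty-trans≈ (⊢sub a dA) (⊢sub a dB) (⊢sub a dD))
    ⊢sub {σ = σ} a (ty-leib≈ {A} dA) =
      ⊢-cast (sym (sub-leibTy σ A)) (ty-leib≈ (⊢sub a dA))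
    ⊢sub {σ = σ} a (ty-cong≈ {A} {B} {A'} {B'} dA dB dA' dB') =
      ⊢-cast (sym (sub-congTy σ A B A' B'))
        (ty-cong≈ (⊢sub a dA) (⊢sub (lift-admissible a dA) dB)
                  (⊢sub a dA') (⊢sub (lift-admissible a dA') dB'))
    ⊢sub {σ = σ} a (ty-ext≈ {A} {B} {A'} {B'} dA dB dA' dB') =
      ⊢-cast (sym (sub-extTy σ A B A' B'))
        (ty-ext≈ (⊢sub a dA) (⊢sub (lift-admissible a dA) dB)
                 (⊢sub a dA') (⊢sub (lift-admissible a dA') dB'))

    lift-admissible : {Γ : Ctx C m} {σ : Sub C m n} {Δ : Ctx C n} {A : Term C m} →
                      Admissible Γ σ Δ → sig ∣ Γ ⊢ A ∶ type →
                      Admissible (Γ ▹ A) (liftS σ) (Δ ▹ sub σ A)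
    lift-admissible a dA = admissible-lift a (⊢sub a dA)

wk-[] : (B u : Term C n) → wk B [ u ] ≡ B
wk-[] B u = trans ([]-as-sub (wk B) u) (trans (sub-ren (var ,ₛ u) suc B) (sub-id (λ _ → refl) B))

γ₁₂-γ₁ : (Γ : Ctx C n) → γ₁₂ Γ ∘ γ₁ ≗ var
γ₁₂-γ₁ (Γ ▹ A) zero    = refl
γ₁₂-γ₁ (Γ ▹ A) (suc i) = cong wk (γ₁₂-γ₁ Γ i)

γ₁₂-γ₂ : (Γ : Ctx C n) → γ₁₂ Γ ∘ γ₂ ≗ var
γ₁₂-γ₂ (Γ ▹ A) zero    = refl
γ₁₂-γ₂ (Γ ▹ A) (suc i) = cong wk (γ₁₂-γ₂ Γ i)

sub-γ₁₂-ren-γ₁ : (Γ : Ctx C n) (A : Term C n) → sub (γ₁₂ Γ) (ren γ₁ A) ≡ A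
sub-γ₁₂-ren-γ₁ Γ A = trans (sub-ren (γ₁₂ Γ) γ₁ A) (sub-id (γ₁₂-γ₁ Γ) A)

sub-γ₁₂-ren-γ₂ : (Γ : Ctx C n) (A : Term C n) → sub (γ₁₂ Γ) (ren γ₂ A) ≡ A
sub-γ₁₂-ren-γ₂ Γ A = trans (sub-ren (γ₁₂ Γ) γ₂ A) (sub-id (γ₁₂-γ₂ Γ) A)

sub-γ₁₂-wk³ : (Γ : Ctx C n) (A : Term C n) (X : Term C (triple n)) →
              sub (γ₁₂ (Γ ▹ A)) (wk (wk (wk X))) ≡ wk (sub (γ₁₂ Γ) X)
sub-γ₁₂-wk³ Γ A X = begin
  sub γ (wk (wk (wk X)))                ≡⟨ sub-ren γ suc (wk (wk X)) ⟩
  sub (λ i → γ (suc i)) (wk (wk X))     ≡⟨ sub-ren _ suc (wk X) ⟩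
  sub (λ i → γ (suc (suc i))) (wk X)    ≡⟨ sub-ren _ suc X ⟩
  sub (wk ∘ γ₁₂ Γ) X                    ≡⟨ sym (ren-sub suc (γ₁₂ Γ) X) ⟩
  wk (sub (γ₁₂ Γ) X)                    ∎
  where
  open ≡-Reasoning
  γ = γ₁₂ (Γ ▹ A)

γ₁₂-type-z₁ : (Γ : Ctx C n) (A : Term C n) →
              sub (γ₁₂ (Γ ▹ A)) (lookup (Pack (Γ ▹ A) (Γ ▹ A)) v2) ≡ wk A
γ₁₂-type-z₁ Γ A = trans (sub-γ₁₂-wk³ Γ A (ren γ₁ A)) (cong wk (sub-γ₁₂-ren-γ₁ Γ A))

γ₁₂-type-z₂ : (Γ : Ctx C n) (A : Term C n) →
              sub (γ₁₂ (Γ ▹ A)) (lookup (Pack (Γ ▹ A) (Γ ▹ A)) v1) ≡ wk A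
γ₁₂-type-z₂ Γ A = begin
  sub γ (wk (wk (ren (suc ∘ γ₂) A)))  ≡⟨ cong (sub γ ∘ wk ∘ wk) (sym (ren-ren suc γ₂ A)) ⟩
  sub γ (wk (wk (wk (ren γ₂ A))))     ≡⟨ sub-γ₁₂-wk³ Γ A (ren γ₂ A) ⟩
  wk (sub (γ₁₂ Γ) (ren γ₂ A))         ≡⟨ cong wk (sub-γ₁₂-ren-γ₂ Γ A) ⟩
  wk A                                ∎
  where
  open ≡-Reasoning
  γ = γ₁₂ (Γ ▹ A)

γ₁₂-type-p : (Γ : Ctx C n) (A : Term C n) →
             sub (γ₁₂ (Γ ▹ A)) (lookup (Pack (Γ ▹ A) (Γ ▹ A)) v0) ≡
             Eq≈ (wk A) (wk A) (var v0) (var v0)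
γ₁₂-type-p Γ A = Eq≈-cong
  (trans (cong (sub (γ₁₂ (Γ ▹ A)) ∘ wk) (wk^-suc 1 (ren γ₁ A))) (γ₁₂-type-z₁ Γ A))
  (γ₁₂-type-z₂ Γ A)

module WellTyped {C : Set} (sig : C → Term C 0) where

  record WtRen (Γ : Ctx C m) (σ : Sub C m n) (Δ : Ctx C n) : Set where
    constructor _,_
    field
      wf        : WfCtx sig Δ
      var-image : ∀ i → ∃ λ j → σ i ≡ var j × lookup Δ j ≡ sub σ (lookup Γ i)

  WtRen-var : {Γ : Ctx C m} {σ : Sub C m n} {Δ : Ctx C n} → WtRen Γ σ Δ →
              ∀ i → sig ∣ Δ ⊢ σ i ∶ sub σ (lookup Γ i)
  WtRen-var (wf , image) i with image i
  ... | j , σi≡j , lookup-j = subst₂ (sig ∣ _ ⊢_∶_) (sym σi≡j) lookup-j (ty-var wf)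

  WtRen-lift : {Γ : Ctx C m} {σ : Sub C m n} {Δ : Ctx C n} {A : Term C m} → WtRen Γ σ Δ →
               sig ∣ Δ ⊢ sub σ A ∶ type → WtRen (Γ ▹ A) (liftS σ) (Δ ▹ sub σ A)
  WtRen-lift {Γ = Γ} {σ} {A = A} (wf , image) ⊢A = wf-, wf ⊢A , image↑
    where
    image↑ : ∀ i → ∃ λ j → liftS σ i ≡ var j ×
                           lookup (_ ▹ sub σ A) j ≡ sub (liftS σ) (lookup (Γ ▹ A) i)
    image↑ zero    = zero , refl , sym (sub-wk σ A)
    image↑ (suc i) with image i
    ... | j , σi≡j , lookup-j =
      suc j , cong wk σi≡j , trans (cong wk lookup-j) (sym (sub-wk σ (lookup Γ i)))

  module RenamingPreservation = Preservation sig WtRen WtRen.wf WtRen-var WtRen-lift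

  ⊢wk : {Γ : Ctx C n} {B t T : Term C n} → WfCtx sig Γ → sig ∣ Γ ⊢ B ∶ type →
        sig ∣ Γ ⊢ t ∶ T → sig ∣ Γ ▹ B ⊢ wk t ∶ wk T
  ⊢wk {Γ = Γ} {t = t} {T} wf ⊢B ⊢t =
    subst₂ (sig ∣ _ ⊢_∶_) (sym (wk-as-sub t)) (sym (wk-as-sub T))
      (RenamingPreservation.⊢sub (wf-, wf ⊢B , λ i → suc i , refl , wk-as-sub (lookup Γ i)) ⊢t)

  record WtSub (Γ : Ctx C m) (σ : Sub C m n) (Δ : Ctx C n) : Set where
    constructor _,_
    field
      wf : WfCtx sig Δ
      ⊢σ : ∀ i → sig ∣ Δ ⊢ σ i ∶ sub σ (lookup Γ i)

  WtSub-lift : {Γ : Ctx C m} {σ : Sub C m n} {Δ : Ctx C n} {A : Term C m} → WtSub Γ σ Δ →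
               sig ∣ Δ ⊢ sub σ A ∶ type → WtSub (Γ ▹ A) (liftS σ) (Δ ▹ sub σ A)
  WtSub-lift {Γ = Γ} {σ} {A = A} (wf , ⊢σ) ⊢A = wf-, wf ⊢A , ⊢σ↑
    where
    ⊢σ↑ : ∀ i → sig ∣ _ ▹ sub σ A ⊢ liftS σ i ∶ sub (liftS σ) (lookup (Γ ▹ A) i)
    ⊢σ↑ zero    = ⊢-cast (sym (sub-wk σ A)) (ty-var (wf-, wf ⊢A))
    ⊢σ↑ (suc i) = ⊢-cast (sym (sub-wk σ (lookup Γ i))) (⊢wk wf ⊢A (⊢σ i))

  module SubstitutionPreservation = Preservation sig WtSub WtSub.wf WtSub.⊢σ WtSub-lift

  ⊢γ₁₂ : {Γ : Ctx C n} → WfCtx sig Γ → ∀ i → sig ∣ Γ ⊢ γ₁₂ Γ i ∶ sub (γ₁₂ Γ) (lookup (Pack Γ Γ) i)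
  ⊢γ₁₂ (wf-, {Γ = Γ} {A} wf ⊢A) zero =
    ⊢-cast (trans (Eq≈-cong (wk-[] (wk A) (var v0)) (wk-[] (wk A) (var v0)))
                  (sym (γ₁₂-type-p Γ A)))
      (ty-app (ty-refl≈ (⊢wk wf ⊢A ⊢A)) (ty-var (wf-, wf ⊢A)))
  ⊢γ₁₂ (wf-, {Γ = Γ} {A} wf ⊢A) (suc zero) =
    ⊢-cast (sym (γ₁₂-type-z₂ Γ A)) (ty-var (wf-, wf ⊢A))
  ⊢γ₁₂ (wf-, {Γ = Γ} {A} wf ⊢A) (suc (suc zero)) =
    ⊢-cast (sym (γ₁₂-type-z₁ Γ A)) (ty-var (wf-, wf ⊢A))
  ⊢γ₁₂ (wf-, {Γ = Γ} {A} wf ⊢A) (suc (suc (suc i))) =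
    ⊢-cast (sym (sub-γ₁₂-wk³ Γ A (lookup (Pack Γ Γ) i))) (⊢wk wf ⊢A (⊢γ₁₂ wf i))

lemma5 : {C : Set} (sig : C → Term C 0) → WfSig sig →
         {n : ℕ} (Γ : Ctx C n) → WfCtx sig Γ → SmallCtx Γ →
         (t A : Term C (triple n)) →
         sig ∣ Pack Γ Γ ⊢ t ∶ A →
         sig ∣ Γ ⊢ sub (γ₁₂ Γ) t ∶ sub (γ₁₂ Γ) A
lemma5 sig _ Γ wf _ t A ⊢t = SubstitutionPreservation.⊢sub (wf , ⊢γ₁₂ wf) ⊢t
  where open WellTyped sig
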